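{- Let $q\geq 4$ and let $B_q$ be any biaffine plane of order $q$. Then $\mu(B_q)\leq 3q-6$.
   Context: A biaffine plane (flag-type elliptic semiplane) of order $q$ is the incidence structure obtained from an affine plane of order $q$ by deleting all lines of one parallel class (keeping all $q^2$ points). $\mu(B_q)$ denotes the metric dimension of its incidence graph (bipartite graph on points and lines, adjacency = incidence), i.e. the minimum size of a vertex set $S$ such that every two distinct vertices $u\neq v$ have some $s\in S$ with $d(u,s)\neq d(v,s)$. -}

module Defs where

open import Data.Nat using (ℕ; zero; suc; _<_)
open import Data.Bool using (Bool; true; false; T; if_then_else_)
open import Data.Fin using (Fin)
open import Data.List using (List; map; allFin)
open import Data.Nat.ListAction using (sum)
open import Data.List.Membership.Propositional using (_∈_)
open import Data.Product using (Σ; ∃; ∃-syntax; _×_; _,_)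
open import Data.Sum using (_⊎_; inj₁; inj₂)
open import Data.Empty using (⊥)
open import Data.Unit using (⊤)
open import Relation.Nullary using (¬_)
open import Relation.Binary.PropositionalEquality using (_≡_; _≢_)

module Incidence {np nl : ℕ} (I : Fin np → Fin nl → Bool) where

  Inc : Fin np → Fin nl → Set
  Inc p ℓ = T (I p ℓ)

  pointsOn : Fin nl → ℕ
  pointsOn ℓ = sum (map (λ p → if I p ℓ then 1 else 0) (allFin np))

  Disjoint : Fin nl → Fin nl → Set
  Disjoint ℓ m = ∀ p → ¬ (Inc p ℓ × Inc p m)

  Parallel : Fin nl → Fin nl → Set
  Parallel ℓ m = ℓ ≡ m ⊎ Disjoint ℓ m

  record IsAffinePlane (q : ℕ) : Set where
    field
      join        : ∀ p r → p ≢ r → ∃[ ℓ ] (Inc p ℓ × Inc r ℓ)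
      join-unique : ∀ p r ℓ m → p ≢ r → Inc p ℓ → Inc r ℓ → Inc p m → Inc r m → ℓ ≡ m
      playfair    : ∀ p ℓ → ¬ Inc p ℓ → ∃[ m ] (Inc p m × Disjoint m ℓ)
      playfair-unique : ∀ p ℓ m m′ → ¬ Inc p ℓ → Inc p m → Disjoint m ℓ →
                        Inc p m′ → Disjoint m′ ℓ → m ≡ m′
      noncollinear : ∃[ a ] ∃[ b ] ∃[ c ] (¬ (∃[ ℓ ] (Inc a ℓ × Inc b ℓ × Inc c ℓ)))
      order       : ∀ ℓ → pointsOn ℓ ≡ q

  -- The biaffine plane obtained by deleting the parallel class of ℓ₀,
  -- and its incidence graph.
  module Biaffine (ℓ₀ : Fin nl) where

    Kept : Fin nl → Set
    Kept ℓ = ¬ Parallel ℓ ℓ₀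

    Vertex : Set
    Vertex = Fin np ⊎ Fin nl

    Valid : Vertex → Set
    Valid (inj₁ p) = ⊤
    Valid (inj₂ ℓ) = Kept ℓ

    Adj : Vertex → Vertex → Set
    Adj (inj₁ p) (inj₂ ℓ) = Inc p ℓ × Kept ℓ
    Adj (inj₂ ℓ) (inj₁ p) = Inc p ℓ × Kept ℓ
    Adj (inj₁ _) (inj₁ _) = ⊥
    Adj (inj₂ _) (inj₂ _) = ⊥

    data Walk : Vertex → Vertex → ℕ → Set where
      here : ∀ {u} → Walk u u zero
      step : ∀ {u v w n} → Adj u v → Walk v w n → Walk u w (suc n)

    Dist : Vertex → Vertex → ℕ → Set
    Dist u v n = Walk u v n × (∀ m → m < n → ¬ Walk u v m)

    Distinguishes : Vertex → Vertex → Vertex → Set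
    Distinguishes s u v =
      (∃[ n ] (Dist u s n × ¬ Dist v s n)) ⊎ (∃[ n ] (Dist v s n × ¬ Dist u s n))

    Resolving : List Vertex → Set
    Resolving S = ∀ u v → Valid u → Valid v → u ≢ v →
                  ∃[ s ] (s ∈ S × Distinguishes s u v)

-- Call the lines of the deleted class verticals. Fix a kept line a with points p₁ ≠ p₂, two further
-- lines y₁, y₂ parallel to a, the point m of y₁ below p₂, a kept line g through p₂ and the point of
-- y₁ or y₂ below p₁, and put h = the parallel to g through p₁ and k = p₁m. The resolving set S
-- consists of the q − 2 points of a other than p₁, p₂, the point m, the q − 3 lines parallel to a
-- other than a, y₁, y₂, the q − 3 non-vertical lines through p₁ other than a, h, k, and g: 3q − 6
-- vertices. A point of S in the vertical of x (every vertical but that of p₁ has one) separates x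
-- from every point y in another vertical (distance 0 or at least 4 against 2); likewise a line of S
-- parallel to ℓ (every class but that of k has one) separates ℓ from every line not parallel to ℓ;
-- points and lines are separated by parity. Two points of one vertical are separated unless neither
-- lies on an element of S, and the points on no element of S (a few points of y₁ and y₂) lie in
-- pairwise distinct verticals; dually for parallel lines. The only delicate case is a point of
-- y₁ ∩ h below a point of y₂ ∩ k. If some parallelogram with two vertical sides has non-parallel
-- diagonals, building the configuration on it lets the choice of y₂ exclude this case; if all such
-- diagonals are parallel, applying this to parallelograms spanned by the configuration excludes it.

module Submission where

open import Defs
open import Data.Nat using (ℕ; zero; suc; _+_; _*_; _∸_; _≤_; _<_; z≤n; s≤s)
open import Data.Nat.Properties
  using (≤-reflexive; +-cancelˡ-≤; +-monoʳ-<; +-mono-≤; m+n≤o⇒m≤o∸n; anyUpTo?; module ≤-Reasoning)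
open import Data.Nat.Induction using (<-wellFounded)
open import Data.Nat.ListAction using (sum)
open import Data.Bool using (Bool; true; false; if_then_else_)
open import Data.Fin using (Fin)
open import Data.Fin.Properties using (_≟_; any?; all?)
open import Data.List using (List; []; _∷_; _++_; map; filter; length; allFin)
open import Data.List.Properties using (filter-all; filter-notAll; length-++; length-map)
open import Data.List.Membership.Propositional using (_∈_)
open import Data.List.Membership.Propositional.Properties
  using (∈-filter⁺; ∈-filter⁻; ∈-allFin; ∈-map⁺; ∈-++⁺ˡ; ∈-++⁺ʳ)
open import Data.List.Relation.Unary.Any using (here; there)
import Data.List.Relation.Unary.Any as Any
open import Data.List.Relation.Unary.All using (All; []; _∷_)
import Data.List.Relation.Unary.All as All
import Data.List.Relation.Unary.All.Properties as All
open import Data.List.Relation.Unary.AllPairs using ([]; _∷_)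
open import Data.List.Relation.Unary.Unique.Propositional using (Unique)
import Data.List.Relation.Unary.Unique.Propositional.Properties as Unique
open import Data.Product using (∃; ∃-syntax; _×_; _,_; proj₁; proj₂)
open import Data.Sum using (_⊎_; inj₁; inj₂; [_,_]′)
open import Data.Sum.Properties using (inj₁-injective; inj₂-injective; ≡-dec)
open import Data.Empty using (⊥; ⊥-elim)
open import Data.Unit using (tt)
open import Function using (_∘_)
open import Induction.WellFounded using (Acc; acc)
open import Data.Nat.Tactic.RingSolver using (solve-∀)
open import Relation.Binary.Definitions using (DecidableEquality)
open import Relation.Binary.PropositionalEquality
open import Relation.Nullary using (¬_; Dec; yes; no)
open import Relation.Nullary.Decidable using (¬?; _×-dec_; _⊎-dec_; T?; map′; decidable-stable)
import Relation.Unary as U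

sum-indicator≡length-filter : ∀ {A : Set} (f : A → Bool) (xs : List A) →
  sum (map (λ x → if f x then 1 else 0) xs) ≡ length (filter (λ x → T? (f x)) xs)
sum-indicator≡length-filter f [] = refl
sum-indicator≡length-filter f (x ∷ xs) with f x
... | true  = cong suc (sum-indicator≡length-filter f xs)
... | false = sum-indicator≡length-filter f xs

least-witness : ∀ {P : ℕ → Set} → U.Decidable P → ∀ {n} → P n →
                ∃[ k ] (P k × ∀ j → j < k → ¬ P j)
least-witness {P} P? {n} = search n (<-wellFounded n)
  where
  search : ∀ n → Acc _<_ n → P n → ∃[ k ] (P k × ∀ j → j < k → ¬ P j)
  search n (acc smaller) Pn with anyUpTo? P? n
  ... | yes (j , j<n , Pj) = search j (smaller j<n) Pj
  ... | no none = n , Pn , λ j j<n Pj → none (j , j<n , Pj)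

nonempty⇒∈ : ∀ {A : Set} (xs : List A) → 0 < length xs → ∃[ x ] x ∈ xs
nonempty⇒∈ (x ∷ _) _ = x , here refl

module Without {A : Set} (_≟ᴬ_ : DecidableEquality A) where

  infixl 5 _without_
  _without_ : List A → A → List A
  xs without e = filter (λ x → ¬? (x ≟ᴬ e)) xs

  ∈-without⁺ : ∀ {x e xs} → x ∈ xs → x ≢ e → x ∈ xs without e
  ∈-without⁺ {e = e} = ∈-filter⁺ (λ x → ¬? (x ≟ᴬ e))

  ∈-without⁻ : ∀ {x e} xs → x ∈ xs without e → x ∈ xs × x ≢ e
  ∈-without⁻ {e = e} xs = ∈-filter⁻ (λ x → ¬? (x ≟ᴬ e)) {xs = xs}

  length-without-< : ∀ {e xs} → e ∈ xs → length (xs without e) < length xs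
  length-without-< {e} e∈xs =
    filter-notAll (λ x → ¬? (x ≟ᴬ e)) _ (Any.map (λ e≡x x≢e → x≢e (sym e≡x)) e∈xs)

  length-≤-suc-without : ∀ e {xs} → Unique xs → length xs ≤ suc (length (xs without e))
  length-≤-suc-without e {[]} [] = z≤n
  length-≤-suc-without e {x ∷ xs} (x∉xs ∷ unique) with x ≟ᴬ e
  ... | yes refl = s≤s (≤-reflexive (cong length (sym
        (filter-all (λ y → ¬? (y ≟ᴬ e)) (All.map (λ x≢y y≡x → x≢y (sym y≡x)) x∉xs)))))
  ... | no _ = s≤s (length-≤-suc-without e unique)

  unique-without : ∀ e {xs} → Unique xs → Unique (xs without e)
  unique-without e = Unique.filter⁺ (λ x → ¬? (x ≟ᴬ e))

module AffinePlane {q np nl : ℕ} {I : Fin np → Fin nl → Bool}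
                   (plane : Incidence.IsAffinePlane I q) where
  open Incidence I
  open IsAffinePlane plane
  open Without (_≟_ {np}) public

  inc? : ∀ p ℓ → Dec (Inc p ℓ)
  inc? p ℓ = T? (I p ℓ)

  parallel? : ∀ ℓ m → Dec (Parallel ℓ m)
  parallel? ℓ m = (ℓ ≟ m) ⊎-dec all? (λ p → ¬? (inc? p ℓ ×-dec inc? p m))

  ∥-refl : ∀ {ℓ} → Parallel ℓ ℓ
  ∥-refl = inj₁ refl

  disjoint-sym : ∀ {ℓ m} → Disjoint ℓ m → Disjoint m ℓ
  disjoint-sym ℓ∩m p (p∈m , p∈ℓ) = ℓ∩m p (p∈ℓ , p∈m)

  ∥-sym : ∀ {ℓ m} → Parallel ℓ m → Parallel m ℓ
  ∥-sym (inj₁ ℓ≡m) = inj₁ (sym ℓ≡m)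
  ∥-sym (inj₂ ℓ∩m) = inj₂ (disjoint-sym ℓ∩m)

  ∥-trans : ∀ {ℓ m n} → Parallel ℓ m → Parallel m n → Parallel ℓ n
  ∥-trans (inj₁ refl) m∥n = m∥n
  ∥-trans (inj₂ ℓ∩m) (inj₁ refl) = inj₂ ℓ∩m
  ∥-trans {ℓ} {m} {n} (inj₂ ℓ∩m) (inj₂ m∩n) with ℓ ≟ n
  ... | yes ℓ≡n = inj₁ ℓ≡n
  ... | no ℓ≢n = inj₂ λ p (p∈ℓ , p∈n) →
        ℓ≢n (playfair-unique p m ℓ n (λ p∈m → ℓ∩m p (p∈ℓ , p∈m)) p∈ℓ ℓ∩m p∈n (disjoint-sym m∩n))

  ∥-common⇒≡ : ∀ {ℓ m p} → Parallel ℓ m → Inc p ℓ → Inc p m → ℓ ≡ m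
  ∥-common⇒≡ (inj₁ ℓ≡m) _ _ = ℓ≡m
  ∥-common⇒≡ (inj₂ ℓ∩m) p∈ℓ p∈m = ⊥-elim (ℓ∩m _ (p∈ℓ , p∈m))

  distinct-parallels-disjoint : ∀ {ℓ m p} → Parallel ℓ m → ℓ ≢ m → Inc p ℓ → ¬ Inc p m
  distinct-parallels-disjoint ℓ∥m ℓ≢m p∈ℓ p∈m = ℓ≢m (∥-common⇒≡ ℓ∥m p∈ℓ p∈m)

  ¬∥⇒meet : ∀ {ℓ m} → ¬ Parallel ℓ m → ∃[ p ] (Inc p ℓ × Inc p m)
  ¬∥⇒meet {ℓ} {m} ℓ∦m with any? (λ p → inc? p ℓ ×-dec inc? p m)
  ... | yes meet = meet
  ... | no none = ⊥-elim (ℓ∦m (inj₂ λ p p∈ℓ∩m → none (p , p∈ℓ∩m)))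

  meet-unique : ∀ {ℓ m p r} → ℓ ≢ m → Inc p ℓ → Inc p m → Inc r ℓ → Inc r m → p ≡ r
  meet-unique {ℓ} {m} {p} {r} ℓ≢m p∈ℓ p∈m r∈ℓ r∈m with p ≟ r
  ... | yes p≡r = p≡r
  ... | no p≢r = ⊥-elim (ℓ≢m (join-unique p r ℓ m p≢r p∈ℓ r∈ℓ p∈m r∈m))

  parallelThrough : Fin nl → Fin np → Fin nl
  parallelThrough ℓ p with inc? p ℓ
  ... | yes _ = ℓ
  ... | no p∉ℓ = proj₁ (playfair p ℓ p∉ℓ)

  parallelThrough-inc : ∀ ℓ p → Inc p (parallelThrough ℓ p)
  parallelThrough-inc ℓ p with inc? p ℓ
  ... | yes p∈ℓ = p∈ℓ
  ... | no p∉ℓ = proj₁ (proj₂ (playfair p ℓ p∉ℓ))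

  parallelThrough-∥ : ∀ ℓ p → Parallel (parallelThrough ℓ p) ℓ
  parallelThrough-∥ ℓ p with inc? p ℓ
  ... | yes _ = ∥-refl
  ... | no p∉ℓ = inj₂ (proj₂ (proj₂ (playfair p ℓ p∉ℓ)))

  ∥-through-unique : ∀ {ℓ m m′ p} → Inc p m → Parallel m ℓ → Inc p m′ → Parallel m′ ℓ → m ≡ m′
  ∥-through-unique p∈m m∥ℓ p∈m′ m′∥ℓ = ∥-common⇒≡ (∥-trans m∥ℓ (∥-sym m′∥ℓ)) p∈m p∈m′

  parallelThrough-unique : ∀ {ℓ m p} → Inc p m → Parallel m ℓ → m ≡ parallelThrough ℓ p
  parallelThrough-unique {ℓ} {p = p} p∈m m∥ℓ =
    ∥-through-unique p∈m m∥ℓ (parallelThrough-inc ℓ p) (parallelThrough-∥ ℓ p)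

  point-off : ∀ ℓ → ∃[ o ] ¬ Inc o ℓ
  point-off ℓ with noncollinear
  ... | x , y , z , noncol with inc? x ℓ | inc? y ℓ | inc? z ℓ
  ... | no x∉ℓ | _ | _ = x , x∉ℓ
  ... | yes _ | no y∉ℓ | _ = y , y∉ℓ
  ... | yes _ | yes _ | no z∉ℓ = z , z∉ℓ
  ... | yes x∈ℓ | yes y∈ℓ | yes z∈ℓ = ⊥-elim (noncol (ℓ , x∈ℓ , y∈ℓ , z∈ℓ))

  pointsOf : Fin nl → List (Fin np)
  pointsOf ℓ = filter (λ x → inc? x ℓ) (allFin np)

  ∈-pointsOf : ∀ {x ℓ} → Inc x ℓ → x ∈ pointsOf ℓ
  ∈-pointsOf {x} {ℓ} = ∈-filter⁺ (λ x → inc? x ℓ) (∈-allFin x)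

  length-pointsOf : ∀ ℓ → length (pointsOf ℓ) ≡ q
  length-pointsOf ℓ = trans (sym (sum-indicator≡length-filter (λ p → I p ℓ) (allFin np))) (order ℓ)

  unique-pointsOf : ∀ ℓ → Unique (pointsOf ℓ)
  unique-pointsOf ℓ = Unique.filter⁺ (λ x → inc? x ℓ) (Unique.allFin⁺ np)

  length-pointsOf-without₂ : ∀ {ℓ e₁ e₂} → Inc e₁ ℓ → Inc e₂ ℓ → e₂ ≢ e₁ →
                             2 + length (pointsOf ℓ without e₁ without e₂) ≤ q
  length-pointsOf-without₂ {ℓ} {e₁} {e₂} e₁∈ℓ e₂∈ℓ e₂≢e₁ = begin
    2 + length (pointsOf ℓ without e₁ without e₂)
      ≤⟨ +-monoʳ-< 1 (length-without-< (∈-without⁺ (∈-pointsOf e₂∈ℓ) e₂≢e₁)) ⟩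
    1 + length (pointsOf ℓ without e₁)      ≤⟨ length-without-< (∈-pointsOf e₁∈ℓ) ⟩
    length (pointsOf ℓ)                    ≡⟨ length-pointsOf ℓ ⟩
    q                                      ∎
    where open ≤-Reasoning

  length-pointsOf-without₃ : ∀ {ℓ e₁ e₂ e₃} → Inc e₁ ℓ → Inc e₂ ℓ → Inc e₃ ℓ →
                             e₂ ≢ e₁ → e₃ ≢ e₁ → e₃ ≢ e₂ →
                             3 + length (pointsOf ℓ without e₁ without e₂ without e₃) ≤ q
  length-pointsOf-without₃ {ℓ} {e₁} {e₂} {e₃} e₁∈ℓ e₂∈ℓ e₃∈ℓ e₂≢e₁ e₃≢e₁ e₃≢e₂ = begin
    3 + length (pointsOf ℓ without e₁ without e₂ without e₃)
      ≤⟨ +-monoʳ-< 2 (length-without-< (∈-without⁺ (∈-without⁺ (∈-pointsOf e₃∈ℓ) e₃≢e₁) e₃≢e₂)) ⟩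
    2 + length (pointsOf ℓ without e₁ without e₂)
      ≤⟨ length-pointsOf-without₂ e₁∈ℓ e₂∈ℓ e₂≢e₁ ⟩
    q ∎
    where open ≤-Reasoning

  pointsOf-without₃-nonempty : 4 ≤ q → ∀ ℓ e₁ e₂ e₃ → 0 < length (pointsOf ℓ without e₁ without e₂ without e₃)
  pointsOf-without₃-nonempty 4≤q ℓ e₁ e₂ e₃ = +-cancelˡ-≤ 3 _ _ (begin
    4                                                          ≤⟨ 4≤q ⟩
    q                                                          ≡⟨ sym (length-pointsOf ℓ) ⟩
    length (pointsOf ℓ)                                        ≤⟨ length-≤-suc-without e₁ (unique-pointsOf ℓ) ⟩
    1 + length (pointsOf ℓ without e₁)                         ≤⟨ s≤s (length-≤-suc-without e₂ unique₁) ⟩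
    2 + length (pointsOf ℓ without e₁ without e₂)
      ≤⟨ s≤s (s≤s (length-≤-suc-without e₃ (unique-without e₂ unique₁))) ⟩
    3 + length (pointsOf ℓ without e₁ without e₂ without e₃)   ∎)
    where
    open ≤-Reasoning
    unique₁ = unique-without e₁ (unique-pointsOf ℓ)

  ∃-point-avoiding : 4 ≤ q → ∀ ℓ e₁ e₂ e₃ → ∃[ x ] (Inc x ℓ × x ≢ e₁ × x ≢ e₂ × x ≢ e₃)
  ∃-point-avoiding 4≤q ℓ e₁ e₂ e₃
    with nonempty⇒∈ (pointsOf ℓ without e₁ without e₂ without e₃) (pointsOf-without₃-nonempty 4≤q ℓ e₁ e₂ e₃)
  ... | x , x∈₃ with ∈-without⁻ (pointsOf ℓ without e₁ without e₂) x∈₃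
  ... | x∈₂ , x≢e₃ with ∈-without⁻ (pointsOf ℓ without e₁) x∈₂
  ... | x∈₁ , x≢e₂ with ∈-without⁻ (pointsOf ℓ) x∈₁
  ... | x∈ℓ , x≢e₁ = x , proj₂ (∈-filter⁻ (λ x → inc? x ℓ) {xs = allFin np} x∈ℓ) , x≢e₁ , x≢e₂ , x≢e₃

module BiaffinePlane {q np nl : ℕ} {I : Fin np → Fin nl → Bool}
                     (plane : Incidence.IsAffinePlane I q) (ℓ₀ : Fin nl) where
  open Incidence I
  open IsAffinePlane plane
  open AffinePlane plane
  open Biaffine ℓ₀

  kept? : ∀ ℓ → Dec (Kept ℓ)
  kept? ℓ = ¬? (parallel? ℓ ℓ₀)

  kept-∥ : ∀ {ℓ m} → Parallel ℓ m → Kept m → Kept ℓ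
  kept-∥ ℓ∥m m-kept ℓ∥ℓ₀ = m-kept (∥-trans (∥-sym ℓ∥m) ℓ∥ℓ₀)

  vertical : Fin np → Fin nl
  vertical = parallelThrough ℓ₀

  vertical-inc : ∀ p → Inc p (vertical p)
  vertical-inc = parallelThrough-inc ℓ₀

  vertical-not-kept : ∀ p → ¬ Kept (vertical p)
  vertical-not-kept p kept = kept (parallelThrough-∥ ℓ₀ p)

  on-vertical⇒≡ : ∀ {x p} → Inc x (vertical p) → vertical x ≡ vertical p
  on-vertical⇒≡ {x} {p} x∈ = sym (parallelThrough-unique x∈ (parallelThrough-∥ ℓ₀ p))

  ≡⇒on-vertical : ∀ {x p} → vertical x ≡ vertical p → Inc x (vertical p)
  ≡⇒on-vertical {x} eq = subst (Inc x) eq (vertical-inc x)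

  kept-meets-vertical : ∀ {ℓ} → Kept ℓ → ∀ p → ∃[ x ] (Inc x ℓ × vertical x ≡ vertical p)
  kept-meets-vertical {ℓ} kept p with ¬∥⇒meet {ℓ} {vertical p} (λ ℓ∥ → kept (∥-trans ℓ∥ (parallelThrough-∥ ℓ₀ p)))
  ... | x , x∈ℓ , x∈vp = x , x∈ℓ , on-vertical⇒≡ x∈vp

  crossing : ∀ {ℓ} → Kept ℓ → Fin np → Fin np
  crossing kept p = proj₁ (kept-meets-vertical kept p)

  crossing-inc : ∀ {ℓ} (kept : Kept ℓ) p → Inc (crossing kept p) ℓ
  crossing-inc kept p = proj₁ (proj₂ (kept-meets-vertical kept p))

  crossing-below : ∀ {ℓ} (kept : Kept ℓ) p → vertical (crossing kept p) ≡ vertical p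
  crossing-below kept p = proj₂ (proj₂ (kept-meets-vertical kept p))

  kept-vertical-injective : ∀ {ℓ x y} → Kept ℓ → Inc x ℓ → Inc y ℓ → vertical x ≡ vertical y → x ≡ y
  kept-vertical-injective {ℓ} {x} kept x∈ℓ y∈ℓ eq =
    meet-unique (λ ℓ≡ → vertical-not-kept x (subst Kept ℓ≡ kept)) x∈ℓ (vertical-inc x) y∈ℓ (≡⇒on-vertical (sym eq))

  kept-if-distinct-verticals : ∀ {ℓ x y} → Inc x ℓ → Inc y ℓ → vertical x ≢ vertical y → Kept ℓ
  kept-if-distinct-verticals {x = x} x∈ℓ y∈ℓ v≢ ℓ∥ℓ₀ =
    v≢ (sym (on-vertical⇒≡ (subst (Inc _) (parallelThrough-unique x∈ℓ ℓ∥ℓ₀) y∈ℓ)))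

  -- The value ℓ₀ for p ≡ r is junk; every lemma about lineThrough assumes p ≢ r.
  lineThrough : Fin np → Fin np → Fin nl
  lineThrough p r with p ≟ r
  ... | yes _ = ℓ₀
  ... | no p≢r = proj₁ (join p r p≢r)

  lineThrough-inc : ∀ {p r} → p ≢ r → Inc p (lineThrough p r) × Inc r (lineThrough p r)
  lineThrough-inc {p} {r} p≢r with p ≟ r
  ... | yes p≡r = ⊥-elim (p≢r p≡r)
  ... | no p≢r = proj₂ (join p r p≢r)

  lineThrough-unique : ∀ {p r ℓ} → p ≢ r → Inc p ℓ → Inc r ℓ → ℓ ≡ lineThrough p r
  lineThrough-unique {p} {r} {ℓ} p≢r p∈ℓ r∈ℓ =
    join-unique p r ℓ (lineThrough p r) p≢r p∈ℓ r∈ℓ (proj₁ (lineThrough-inc p≢r)) (proj₂ (lineThrough-inc p≢r))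

  distinct-verticals⇒≢ : ∀ {p r} → vertical p ≢ vertical r → p ≢ r
  distinct-verticals⇒≢ v≢ refl = v≢ refl

  lineThrough-kept : ∀ {p r} → vertical p ≢ vertical r → Kept (lineThrough p r)
  lineThrough-kept v≢ = kept-if-distinct-verticals (proj₁ (lineThrough-inc p≢r)) (proj₂ (lineThrough-inc p≢r)) v≢
    where p≢r = distinct-verticals⇒≢ v≢

  adj? : ∀ u v → Dec (Adj u v)
  adj? (inj₁ p) (inj₂ ℓ) = inc? p ℓ ×-dec kept? ℓ
  adj? (inj₂ ℓ) (inj₁ p) = inc? p ℓ ×-dec kept? ℓ
  adj? (inj₁ _) (inj₁ _) = no λ ()
  adj? (inj₂ _) (inj₂ _) = no λ ()

  any-vertex? : ∀ {P : Vertex → Set} → (∀ v → Dec (P v)) → Dec (∃ P)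
  any-vertex? {P} P? with any? (P? ∘ inj₁) | any? (P? ∘ inj₂)
  ... | yes (p , Pp) | _ = yes (inj₁ p , Pp)
  ... | no _ | yes (ℓ , Pℓ) = yes (inj₂ ℓ , Pℓ)
  ... | no no-point | no no-line = no λ where
    (inj₁ p , Pp) → no-point (p , Pp)
    (inj₂ ℓ , Pℓ) → no-line (ℓ , Pℓ)

  walk? : ∀ n u v → Dec (Walk u v n)
  walk? zero u v with ≡-dec _≟_ _≟_ u v
  ... | yes refl = yes here
  ... | no u≢v = no λ { here → u≢v refl }
  walk? (suc n) u v with any-vertex? (λ w → adj? u w ×-dec walk? n w v)
  ... | yes (w , u~w , walk) = yes (step u~w walk)
  ... | no none = no λ { (step u~w walk) → none (_ , u~w , walk) }

  walk⇒dist : ∀ {u v n} → Walk u v n → ∃[ k ] Dist u v k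
  walk⇒dist {u} {v} walk with least-witness (λ n → walk? n u v) walk
  ... | k , walk-k , minimal = k , walk-k , minimal

  walks-parity : ∀ {x ℓ s n} → Walk (inj₁ x) s n → ¬ Walk (inj₂ ℓ) s n
  walks-parity (step {v = inj₂ _} _ walk) (step {v = inj₁ _} _ walk′) = walks-parity walk′ walk

  walk₀ : ∀ {u v} → Walk u v 0 → u ≡ v
  walk₀ here = refl

  walk₂-points : ∀ {x y} → Walk (inj₁ x) (inj₁ y) 2 → ∃[ ℓ ] (Inc x ℓ × Inc y ℓ × Kept ℓ)
  walk₂-points (step {v = inj₂ ℓ} (x∈ℓ , kept) (step (y∈ℓ , _) here)) = ℓ , x∈ℓ , y∈ℓ , kept

  walk₂-lines : ∀ {ℓ m} → Walk (inj₂ ℓ) (inj₂ m) 2 → ∃[ p ] (Inc p ℓ × Inc p m)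
  walk₂-lines (step {v = inj₁ p} (p∈ℓ , _) (step (p∈m , _) here)) = p , p∈ℓ , p∈m

  dist-refl : ∀ {u} → Dist u u 0
  dist-refl = here , λ _ ()

  adj-irrefl : ∀ {u} → ¬ Adj u u
  adj-irrefl {inj₁ _} ()
  adj-irrefl {inj₂ _} ()

  dist-adj : ∀ {u v} → Adj u v → Dist u v 1
  dist-adj u~v = step u~v here , λ where
    zero _ walk → adj-irrefl (subst (Adj _) (sym (walk₀ walk)) u~v)
    (suc _) (s≤s ())

  dist-collinear : ∀ {x s ℓ} → x ≢ s → Inc x ℓ → Inc s ℓ → Kept ℓ → Dist (inj₁ x) (inj₁ s) 2
  dist-collinear {ℓ = ℓ} x≢s x∈ℓ s∈ℓ kept = step {v = inj₂ ℓ} (x∈ℓ , kept) (step (s∈ℓ , kept) here) , shorter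
    where
    shorter : ∀ j → j < 2 → ¬ Walk _ _ j
    shorter zero _ walk = x≢s (inj₁-injective (walk₀ walk))
    shorter (suc zero) _ (step () here)
    shorter (suc (suc _)) (s≤s (s≤s ()))

  dist-concurrent : ∀ {ℓ s p} → ℓ ≢ s → Inc p ℓ → Inc p s → Kept ℓ → Kept s → Dist (inj₂ ℓ) (inj₂ s) 2
  dist-concurrent {p = p} ℓ≢s p∈ℓ p∈s ℓ-kept s-kept =
    step {v = inj₁ p} (p∈ℓ , ℓ-kept) (step (p∈s , s-kept) here) , shorter
    where
    shorter : ∀ j → j < 2 → ¬ Walk _ _ j
    shorter zero _ walk = ℓ≢s (inj₂-injective (walk₀ walk))
    shorter (suc zero) _ (step () here)
    shorter (suc (suc _)) (s≤s (s≤s ()))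

  distinguishes-sym : ∀ {s u v} → Distinguishes s u v → Distinguishes s v u
  distinguishes-sym (inj₁ d) = inj₂ d
  distinguishes-sym (inj₂ d) = inj₁ d

  distinguishes-by-dist : ∀ {s u v k} → Dist u s k → ¬ Walk v s k → Distinguishes s u v
  distinguishes-by-dist dist no-walk = inj₁ (_ , dist , λ dist′ → no-walk (proj₁ dist′))

  distinguishes-self : ∀ {u v} → u ≢ v → Distinguishes u u v
  distinguishes-self u≢v = distinguishes-by-dist dist-refl λ walk → u≢v (sym (walk₀ walk))

  walk₁ : ∀ {u v} → Walk u v 1 → Adj u v
  walk₁ (step u~v here) = u~v

  line-separates-vertical : ∀ {ℓ x y} → Kept ℓ → Inc x ℓ → vertical x ≡ vertical y → x ≢ y →
                            Distinguishes (inj₂ ℓ) (inj₁ x) (inj₁ y)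
  line-separates-vertical kept x∈ℓ v≡ x≢y = distinguishes-by-dist (dist-adj (x∈ℓ , kept)) λ walk →
    x≢y (kept-vertical-injective kept x∈ℓ (proj₁ (walk₁ walk)) v≡)

  point-separates-parallels : ∀ {ℓ n z} → Kept ℓ → Inc z ℓ → Parallel ℓ n → ℓ ≢ n →
                              Distinguishes (inj₁ z) (inj₂ ℓ) (inj₂ n)
  point-separates-parallels kept z∈ℓ ℓ∥n ℓ≢n = distinguishes-by-dist (dist-adj (z∈ℓ , kept)) λ walk →
    distinct-parallels-disjoint ℓ∥n ℓ≢n z∈ℓ (proj₁ (walk₁ walk))

  -- If x ≢ s they are at distance at least 4, while y is at distance 2 from s.
  vertical-point-separates : ∀ {s x y} → vertical x ≡ vertical s → vertical x ≢ vertical y →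
                             Distinguishes (inj₁ s) (inj₁ x) (inj₁ y)
  vertical-point-separates {s} {x} {y} vx≡vs vx≢vy with x ≟ s
  ... | yes refl = distinguishes-self λ x≡y → vx≢vy (cong vertical (inj₁-injective x≡y))
  ... | no x≢s = distinguishes-sym (distinguishes-by-dist
                   (dist-collinear y≢s (proj₁ (lineThrough-inc y≢s)) (proj₂ (lineThrough-inc y≢s))
                                   (lineThrough-kept vy≢vs))
                   no-walk)
    where
    vy≢vs : vertical y ≢ vertical s
    vy≢vs vy≡vs = vx≢vy (trans vx≡vs (sym vy≡vs))
    y≢s = distinct-verticals⇒≢ vy≢vs
    no-walk : ¬ Walk (inj₁ x) (inj₁ s) 2
    no-walk walk with walk₂-points walk
    ... | _ , x∈ℓ , s∈ℓ , kept = x≢s (kept-vertical-injective kept x∈ℓ s∈ℓ vx≡vs)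

  parallel-line-separates : ∀ {s ℓ n} → Kept s → Kept n → Parallel ℓ s → ¬ Parallel ℓ n →
                            Distinguishes (inj₂ s) (inj₂ ℓ) (inj₂ n)
  parallel-line-separates {s} {ℓ} {n} s-kept n-kept ℓ∥s ℓ∦n with ℓ ≟ s
  ... | yes refl = distinguishes-self λ ℓ≡n → ℓ∦n (subst (Parallel ℓ) (inj₂-injective ℓ≡n) ∥-refl)
  ... | no ℓ≢s with ¬∥⇒meet {n} {s} (λ n∥s → ℓ∦n (∥-trans ℓ∥s (∥-sym n∥s)))
  ...   | p , p∈n , p∈s =
    distinguishes-sym (distinguishes-by-dist (dist-concurrent n≢s p∈n p∈s n-kept s-kept) no-walk)
    where
    n≢s : n ≢ s
    n≢s refl = ℓ∦n ℓ∥s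
    no-walk : ¬ Walk (inj₂ ℓ) (inj₂ s) 2
    no-walk walk with walk₂-lines walk
    ... | r , r∈ℓ , r∈s = distinct-parallels-disjoint ℓ∥s ℓ≢s r∈ℓ r∈s

  _++ʷ_ : ∀ {u v w n k} → Walk u v n → Walk v w k → Walk u w (n + k)
  here ++ʷ walk′ = walk′
  step u~v walk ++ʷ walk′ = step u~v (walk ++ʷ walk′)

  walk-via-line : ∀ {x y} → vertical x ≢ vertical y → Walk (inj₁ x) (inj₁ y) 2
  walk-via-line {x} {y} v≢ =
    step {v = inj₂ (lineThrough x y)} (proj₁ (lineThrough-inc x≢y) , kept)
      (step (proj₂ (lineThrough-inc x≢y) , kept) here)
    where
    x≢y = distinct-verticals⇒≢ v≢
    kept = lineThrough-kept v≢

  points-connected : ∀ x y → ∃[ n ] Walk (inj₁ x) (inj₁ y) n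
  points-connected x y with vertical x ≟ vertical y
  ... | no v≢ = 2 , walk-via-line v≢
  ... | yes vx≡vy with point-off (vertical x)
  ...   | o , o∉vx = 4 , walk-via-line vx≢vo ++ʷ walk-via-line vo≢vy
    where
    vx≢vo : vertical x ≢ vertical o
    vx≢vo vx≡vo = o∉vx (≡⇒on-vertical (sym vx≡vo))
    vo≢vy : vertical o ≢ vertical y
    vo≢vy vo≡vy = vx≢vo (trans vx≡vy (sym vo≡vy))

  -- Point–point walks have even length and line–point walks odd length.
  point-separates-point-line : ∀ s x ℓ → Distinguishes (inj₁ s) (inj₁ x) (inj₂ ℓ)
  point-separates-point-line s x ℓ with walk⇒dist (proj₂ (points-connected x s))
  ... | _ , dist = distinguishes-by-dist dist (walks-parity (proj₁ dist))

module Configurations {q np nl : ℕ} {I : Fin np → Fin nl → Bool}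
                      (plane : Incidence.IsAffinePlane I q) (ℓ₀ : Fin nl) where
  open Incidence I
  open IsAffinePlane plane
  open Biaffine ℓ₀
  open AffinePlane plane
  open BiaffinePlane plane ℓ₀

  record Configuration : Set where
    field
      a           : Fin nl
      a-kept      : Kept a
      p₁ p₂       : Fin np
      p₁∈a        : Inc p₁ a
      p₂∈a        : Inc p₂ a
      p₁≢p₂       : p₁ ≢ p₂
      y₁ y₂       : Fin nl
      y₁∥a        : Parallel y₁ a
      y₂∥a        : Parallel y₂ a
      y₁≢a        : y₁ ≢ a
      y₂≢a        : y₂ ≢ a
      y₁≢y₂       : y₁ ≢ y₂
      m           : Fin np
      m∈y₁        : Inc m y₁
      m-below-p₂  : vertical m ≡ vertical p₂
      g           : Fin nl
      g-kept      : Kept g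
      p₂∈g        : Inc p₂ g
      g-meets-y   : ∃[ w ] (Inc w g × vertical w ≡ vertical p₁ × (Inc w y₁ ⊎ Inc w y₂))
      m∉h         : ¬ Inc m (parallelThrough g p₁)
      no-bad      : ∀ {x y} → Inc x y₁ → Inc x (parallelThrough g p₁) →
                    Inc y y₂ → Inc y (lineThrough p₁ m) → vertical x ≢ vertical y

  module ResolvingSet (4≤q : 4 ≤ q) (C : Configuration) where
    open Configuration C

    h k : Fin nl
    h = parallelThrough g p₁
    k = lineThrough p₁ m

    y₁-kept : Kept y₁
    y₁-kept = kept-∥ y₁∥a a-kept

    y₂-kept : Kept y₂
    y₂-kept = kept-∥ y₂∥a a-kept

    h∥g : Parallel h g
    h∥g = parallelThrough-∥ g p₁

    p₁∈h : Inc p₁ h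
    p₁∈h = parallelThrough-inc g p₁

    h-kept : Kept h
    h-kept = kept-∥ h∥g g-kept

    y₁-avoids-a : ∀ {x} → Inc x y₁ → ¬ Inc x a
    y₁-avoids-a = distinct-parallels-disjoint y₁∥a y₁≢a

    y₂-avoids-a : ∀ {x} → Inc x y₂ → ¬ Inc x a
    y₂-avoids-a = distinct-parallels-disjoint y₂∥a y₂≢a

    y₁-avoids-y₂ : ∀ {x} → Inc x y₁ → ¬ Inc x y₂
    y₁-avoids-y₂ = distinct-parallels-disjoint (∥-trans y₁∥a (∥-sym y₂∥a)) y₁≢y₂

    p₁∉y₁ : ¬ Inc p₁ y₁
    p₁∉y₁ p₁∈y₁ = y₁-avoids-a p₁∈y₁ p₁∈a

    p₁∉y₂ : ¬ Inc p₁ y₂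
    p₁∉y₂ p₁∈y₂ = y₂-avoids-a p₁∈y₂ p₁∈a

    vp₁≢vp₂ : vertical p₁ ≢ vertical p₂
    vp₁≢vp₂ v≡ = p₁≢p₂ (kept-vertical-injective a-kept p₁∈a p₂∈a v≡)

    vp₁≢vm : vertical p₁ ≢ vertical m
    vp₁≢vm v≡ = vp₁≢vp₂ (trans v≡ m-below-p₂)

    p₁≢m : p₁ ≢ m
    p₁≢m = distinct-verticals⇒≢ vp₁≢vm

    p₁∈k : Inc p₁ k
    p₁∈k = proj₁ (lineThrough-inc p₁≢m)

    m∈k : Inc m k
    m∈k = proj₂ (lineThrough-inc p₁≢m)

    k-kept : Kept k
    k-kept = lineThrough-kept vp₁≢vm

    p₁-only-below-p₁ : ∀ {ℓ x} → Kept ℓ → Inc p₁ ℓ → Inc x ℓ → vertical x ≡ vertical p₁ → x ≡ p₁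
    p₁-only-below-p₁ kept p₁∈ℓ x∈ℓ = kept-vertical-injective kept x∈ℓ p₁∈ℓ

    not-below-p₁⇒p₁≢ : ∀ {x} → vertical x ≢ vertical p₁ → p₁ ≢ x
    not-below-p₁⇒p₁≢ vx≢vp₁ = distinct-verticals⇒≢ (vx≢vp₁ ∘ sym)

    g≢a : g ≢ a
    g≢a g≡a with g-meets-y
    ... | w , w∈g , _ , inj₁ w∈y₁ = y₁-avoids-a w∈y₁ (subst (Inc w) g≡a w∈g)
    ... | w , w∈g , _ , inj₂ w∈y₂ = y₂-avoids-a w∈y₂ (subst (Inc w) g≡a w∈g)

    h∦a : ¬ Parallel h a
    h∦a h∥a = g≢a (∥-common⇒≡ (∥-trans (∥-sym h∥g) h∥a) p₂∈g p₂∈a)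

    w₁ w₂ z : Fin np
    w₁ = crossing y₁-kept p₁
    w₂ = crossing y₂-kept p₁
    z = crossing h-kept p₂

    w₁∈y₁ : Inc w₁ y₁
    w₁∈y₁ = crossing-inc y₁-kept p₁

    w₂∈y₂ : Inc w₂ y₂
    w₂∈y₂ = crossing-inc y₂-kept p₁

    z∈h : Inc z h
    z∈h = crossing-inc h-kept p₂

    w₁-below-p₁ : vertical w₁ ≡ vertical p₁
    w₁-below-p₁ = crossing-below y₁-kept p₁

    w₂-below-p₁ : vertical w₂ ≡ vertical p₁
    w₂-below-p₁ = crossing-below y₂-kept p₁

    z-below-p₂ : vertical z ≡ vertical p₂
    z-below-p₂ = crossing-below h-kept p₂

    A-points Y-points L-points : List (Fin np)
    A-points = pointsOf a without p₁ without p₂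
    Y-points = pointsOf (vertical p₁) without p₁ without w₁ without w₂
    L-points = pointsOf (vertical p₂) without p₂ without m without z

    S : List Vertex
    S = map inj₁ A-points ++ inj₁ m ∷ map (inj₂ ∘ parallelThrough a) Y-points
        ++ map (inj₂ ∘ lineThrough p₁) L-points ++ inj₂ g ∷ []

    ∈S-A : ∀ {x} → Inc x a → x ≢ p₁ → x ≢ p₂ → inj₁ x ∈ S
    ∈S-A x∈a x≢p₁ x≢p₂ = ∈-++⁺ˡ (∈-map⁺ inj₁ (∈-without⁺ (∈-without⁺ (∈-pointsOf x∈a) x≢p₁) x≢p₂))

    m∈S : inj₁ m ∈ S
    m∈S = ∈-++⁺ʳ (map inj₁ A-points) (here refl)

    ∈S-Y : ∀ {x} → vertical x ≡ vertical p₁ → x ≢ p₁ → x ≢ w₁ → x ≢ w₂ → inj₂ (parallelThrough a x) ∈ S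
    ∈S-Y x-below x≢p₁ x≢w₁ x≢w₂ = ∈-++⁺ʳ (map inj₁ A-points) (there (∈-++⁺ˡ
      (∈-map⁺ (inj₂ ∘ parallelThrough a)
        (∈-without⁺ (∈-without⁺ (∈-without⁺ (∈-pointsOf (≡⇒on-vertical x-below)) x≢p₁) x≢w₁) x≢w₂))))

    ∈S-L : ∀ {x} → vertical x ≡ vertical p₂ → x ≢ p₂ → x ≢ m → x ≢ z → inj₂ (lineThrough p₁ x) ∈ S
    ∈S-L x-below x≢p₂ x≢m x≢z = ∈-++⁺ʳ (map inj₁ A-points) (there (∈-++⁺ʳ (map (inj₂ ∘ parallelThrough a) Y-points)
      (∈-++⁺ˡ (∈-map⁺ (inj₂ ∘ lineThrough p₁)
        (∈-without⁺ (∈-without⁺ (∈-without⁺ (∈-pointsOf (≡⇒on-vertical x-below)) x≢p₂) x≢m) x≢z)))))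

    g∈S : inj₂ g ∈ S
    g∈S = ∈-++⁺ʳ (map inj₁ A-points) (there (∈-++⁺ʳ (map (inj₂ ∘ parallelThrough a) Y-points)
      (∈-++⁺ʳ (map (inj₂ ∘ lineThrough p₁) L-points) (here refl))))

    ∈L⇒below-p₂ : ∀ {x} → x ∈ L-points → vertical x ≡ vertical p₂
    ∈L⇒below-p₂ x∈ =
      on-vertical⇒≡ (proj₂ (∈-filter⁻ (λ x → inc? x (vertical p₂)) {xs = allFin np}
        (proj₁ (∈-without⁻ (pointsOf (vertical p₂))
          (proj₁ (∈-without⁻ (pointsOf (vertical p₂) without p₂)
            (proj₁ (∈-without⁻ (pointsOf (vertical p₂) without p₂ without m) x∈))))))))

    valid : All Valid S
    valid = All.++⁺ (All.map⁺ (All.universal (λ _ → tt) A-points))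
      (tt ∷ All.++⁺ (All.map⁺ (All.universal (λ x → kept-∥ (parallelThrough-∥ a x) a-kept) Y-points))
        (All.++⁺ (All.map⁺ (All.tabulate λ x∈ → lineThrough-kept λ v≡ → vp₁≢vp₂ (trans v≡ (∈L⇒below-p₂ x∈))))
          (g-kept ∷ [])))

    S-line-kept : ∀ {ℓ} → inj₂ ℓ ∈ S → Kept ℓ
    S-line-kept = All.lookup valid

    w₁≢p₁ : w₁ ≢ p₁
    w₁≢p₁ w₁≡p₁ = p₁∉y₁ (subst (λ x → Inc x y₁) w₁≡p₁ w₁∈y₁)

    w₂≢p₁ : w₂ ≢ p₁
    w₂≢p₁ w₂≡p₁ = p₁∉y₂ (subst (λ x → Inc x y₂) w₂≡p₁ w₂∈y₂)

    w₂≢w₁ : w₂ ≢ w₁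
    w₂≢w₁ w₂≡w₁ = y₁-avoids-y₂ w₁∈y₁ (subst (λ x → Inc x y₂) w₂≡w₁ w₂∈y₂)

    m≢p₂ : m ≢ p₂
    m≢p₂ m≡p₂ = y₁-avoids-a m∈y₁ (subst (λ x → Inc x a) (sym m≡p₂) p₂∈a)

    z≢p₂ : z ≢ p₂
    z≢p₂ z≡p₂ = g≢a (join-unique p₁ p₂ g a p₁≢p₂ (subst (Inc p₁) h≡g p₁∈h) p₂∈g p₁∈a p₂∈a)
      where
      h≡g : h ≡ g
      h≡g = ∥-common⇒≡ h∥g (subst (λ x → Inc x h) z≡p₂ z∈h) p₂∈g

    z≢m : z ≢ m
    z≢m z≡m = m∉h (subst (λ x → Inc x h) z≡m z∈h)

    length-S : length S ≡ length A-points + suc (length Y-points + (length L-points + 1))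
    length-S = begin
      length S
        ≡⟨ length-++ (map inj₁ A-points) ⟩
      length (map inj₁ A-points) + suc (length (map (inj₂ ∘ parallelThrough a) Y-points ++ rest))
        ≡⟨ cong₂ (λ A R → A + suc R) (length-map inj₁ A-points) (length-++ (map (inj₂ ∘ parallelThrough a) Y-points)) ⟩
      length A-points + suc (length (map (inj₂ ∘ parallelThrough a) Y-points) + length rest)
        ≡⟨ cong₂ (λ Y R → length A-points + suc (Y + R)) (length-map (inj₂ ∘ parallelThrough a) Y-points)
                 (length-++ (map (inj₂ ∘ lineThrough p₁) L-points)) ⟩
      length A-points + suc (length Y-points + (length (map (inj₂ ∘ lineThrough p₁) L-points) + 1))
        ≡⟨ cong (λ L → length A-points + suc (length Y-points + (L + 1))) (length-map (inj₂ ∘ lineThrough p₁) L-points) ⟩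
      length A-points + suc (length Y-points + (length L-points + 1)) ∎
      where
      open ≡-Reasoning
      rest = map (inj₂ ∘ lineThrough p₁) L-points ++ inj₂ g ∷ []

    size : length S ≤ 3 * q ∸ 6
    size = m+n≤o⇒m≤o∸n (length S) (begin
      length S + 6
        ≡⟨ cong (_+ 6) length-S ⟩
      length A-points + suc (length Y-points + (length L-points + 1)) + 6
        ≡⟨ regroup (length A-points) (length Y-points) (length L-points) ⟩
      (2 + length A-points) + ((3 + length Y-points) + (3 + length L-points))
        ≤⟨ +-mono-≤ (length-pointsOf-without₂ p₁∈a p₂∈a (p₁≢p₂ ∘ sym))
            (+-mono-≤ (length-pointsOf-without₃ (vertical-inc p₁) (≡⇒on-vertical w₁-below-p₁)
                         (≡⇒on-vertical w₂-below-p₁) w₁≢p₁ w₂≢p₁ w₂≢w₁)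
                      (length-pointsOf-without₃ (vertical-inc p₂) (≡⇒on-vertical m-below-p₂)
                         (≡⇒on-vertical z-below-p₂) m≢p₂ z≢p₂ z≢m)) ⟩
      q + (q + q)
        ≡⟨ triple q ⟩
      3 * q ∎)
      where
      open ≤-Reasoning
      regroup : ∀ A Y L → A + suc (Y + (L + 1)) + 6 ≡ (2 + A) + ((3 + Y) + (3 + L))
      regroup = solve-∀
      triple : ∀ n → n + (n + n) ≡ 3 * n
      triple = solve-∀

    pencil-line∈S : ∀ {ℓ} → Kept ℓ → Inc p₁ ℓ → ℓ ≢ a → ℓ ≢ k → ℓ ≢ h → inj₂ ℓ ∈ S
    pencil-line∈S {ℓ} kept p₁∈ℓ ℓ≢a ℓ≢k ℓ≢h with kept-meets-vertical kept p₂
    ... | x , x∈ℓ , x-below = subst (λ ℓ → inj₂ ℓ ∈ S) (sym (lineThrough-unique p₁≢x p₁∈ℓ x∈ℓ))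
                                (∈S-L x-below x≢p₂ x≢m x≢z)
      where
      p₁≢x : p₁ ≢ x
      p₁≢x = not-below-p₁⇒p₁≢ λ v≡ → vp₁≢vp₂ (trans (sym v≡) x-below)
      x≢p₂ : x ≢ p₂
      x≢p₂ refl = ℓ≢a (join-unique p₁ x ℓ a p₁≢x p₁∈ℓ x∈ℓ p₁∈a p₂∈a)
      x≢m : x ≢ m
      x≢m refl = ℓ≢k (lineThrough-unique p₁≢m p₁∈ℓ x∈ℓ)
      x≢z : x ≢ z
      x≢z refl = ℓ≢h (join-unique p₁ x ℓ h p₁≢x p₁∈ℓ x∈ℓ p₁∈h z∈h)

    class-line∈S : ∀ {ℓ} → Parallel ℓ a → ℓ ≢ a → ℓ ≢ y₁ → ℓ ≢ y₂ → inj₂ ℓ ∈ S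
    class-line∈S {ℓ} ℓ∥a ℓ≢a ℓ≢y₁ ℓ≢y₂ with kept-meets-vertical (kept-∥ ℓ∥a a-kept) p₁
    ... | x , x∈ℓ , x-below = subst (λ ℓ → inj₂ ℓ ∈ S) (sym (parallelThrough-unique x∈ℓ ℓ∥a))
                                (∈S-Y x-below x≢p₁ x≢w₁ x≢w₂)
      where
      x≢p₁ : x ≢ p₁
      x≢p₁ refl = ℓ≢a (∥-common⇒≡ ℓ∥a x∈ℓ p₁∈a)
      x≢w₁ : x ≢ w₁
      x≢w₁ refl = ℓ≢y₁ (∥-through-unique x∈ℓ ℓ∥a w₁∈y₁ y₁∥a)
      x≢w₂ : x ≢ w₂
      x≢w₂ refl = ℓ≢y₂ (∥-through-unique x∈ℓ ℓ∥a w₂∈y₂ y₂∥a)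

    Resolved : Vertex → Vertex → Set
    Resolved u v = ∃[ s ] (s ∈ S × Distinguishes s u v)

    resolved-sym : ∀ {u v} → Resolved u v → Resolved v u
    resolved-sym (s , s∈S , d) = s , s∈S , distinguishes-sym d

    Marked : Fin np → Set
    Marked x = inj₁ x ∈ S ⊎ ∃[ ℓ ] (inj₂ ℓ ∈ S × Inc x ℓ)

    data Exceptional₁ (x : Fin np) : Set where
      below-p₁ : vertical x ≡ vertical p₁ → ¬ Inc x g → Exceptional₁ x
      on-h     : Inc x h → Exceptional₁ x

    data Exceptional₂ (x : Fin np) : Set where
      below-p₁ : vertical x ≡ vertical p₁ → ¬ Inc x g → Exceptional₂ x
      on-k     : Inc x k → Exceptional₂ x
      on-h     : Inc x h → Exceptional₂ x

    Exceptional : Fin np → Set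
    Exceptional x = (Inc x y₁ × Exceptional₁ x) ⊎ (Inc x y₂ × Exceptional₂ x)

    p₁-marked : Marked p₁
    p₁-marked with ∃-point-avoiding 4≤q (vertical p₂) p₂ m z
    ... | x , x∈ , x≢p₂ , x≢m , x≢z =
      inj₂ (lineThrough p₁ x , ∈S-L x-below x≢p₂ x≢m x≢z , proj₁ (lineThrough-inc p₁≢x))
      where
      x-below = on-vertical⇒≡ x∈
      p₁≢x = not-below-p₁⇒p₁≢ λ v≡ → vp₁≢vp₂ (trans (sym v≡) x-below)

    on-a-marked : ∀ {x} → Inc x a → Marked x
    on-a-marked {x} x∈a with x ≟ p₁ | x ≟ p₂
    ... | yes refl | _ = p₁-marked
    ... | no _ | yes refl = inj₂ (g , g∈S , p₂∈g)
    ... | no x≢p₁ | no x≢p₂ = inj₁ (∈S-A x∈a x≢p₁ x≢p₂)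

    on-lineThrough-p₁ : ∀ {x} → vertical x ≢ vertical p₁ → Inc x (lineThrough p₁ x)
    on-lineThrough-p₁ vx≢vp₁ = proj₂ (lineThrough-inc (not-below-p₁⇒p₁≢ vx≢vp₁))

    pencil-marks : ∀ {x} → vertical x ≢ vertical p₁ → ¬ Inc x a →
                   lineThrough p₁ x ≢ k → lineThrough p₁ x ≢ h → Marked x
    pencil-marks {x} vx≢vp₁ x∉a ≢k ≢h =
      inj₂ (lineThrough p₁ x , pencil-line∈S (lineThrough-kept (vx≢vp₁ ∘ sym)) p₁∈ ≢a ≢k ≢h , x∈)
      where
      p₁∈ = proj₁ (lineThrough-inc (not-below-p₁⇒p₁≢ vx≢vp₁))
      x∈ = on-lineThrough-p₁ vx≢vp₁
      ≢a : lineThrough p₁ x ≢ a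
      ≢a ≡a = x∉a (subst (Inc x) ≡a x∈)

    on-y₁-classified : ∀ {x} → Inc x y₁ → Marked x ⊎ Exceptional x
    on-y₁-classified {x} x∈y₁ with x ≟ m | inc? x g | vertical x ≟ vertical p₁
    ... | yes refl | _ | _ = inj₁ (inj₁ m∈S)
    ... | no _ | yes x∈g | _ = inj₁ (inj₂ (g , g∈S , x∈g))
    ... | no _ | no x∉g | yes below = inj₂ (inj₁ (x∈y₁ , below-p₁ below x∉g))
    ... | no x≢m | no _ | no off with lineThrough p₁ x ≟ h
    ...   | yes ≡h = inj₂ (inj₁ (x∈y₁ , on-h (subst (Inc x) ≡h (on-lineThrough-p₁ off))))
    ...   | no ≢h = inj₁ (pencil-marks off (y₁-avoids-a x∈y₁) ≢k ≢h)
      where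
      k≢y₁ : k ≢ y₁
      k≢y₁ k≡y₁ = p₁∉y₁ (subst (Inc p₁) k≡y₁ p₁∈k)
      ≢k : lineThrough p₁ x ≢ k
      ≢k ≡k = x≢m (meet-unique k≢y₁ (subst (Inc x) ≡k (on-lineThrough-p₁ off)) x∈y₁ m∈k m∈y₁)

    on-y₂-classified : ∀ {x} → Inc x y₂ → Marked x ⊎ Exceptional x
    on-y₂-classified {x} x∈y₂ with inc? x g | vertical x ≟ vertical p₁
    ... | yes x∈g | _ = inj₁ (inj₂ (g , g∈S , x∈g))
    ... | no x∉g | yes below = inj₂ (inj₂ (x∈y₂ , below-p₁ below x∉g))
    ... | no _ | no off with lineThrough p₁ x ≟ k | lineThrough p₁ x ≟ h
    ...   | yes ≡k | _ = inj₂ (inj₂ (x∈y₂ , on-k (subst (Inc x) ≡k (on-lineThrough-p₁ off))))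
    ...   | no _ | yes ≡h = inj₂ (inj₂ (x∈y₂ , on-h (subst (Inc x) ≡h (on-lineThrough-p₁ off))))
    ...   | no ≢k | no ≢h = inj₁ (pencil-marks off (y₂-avoids-a x∈y₂) ≢k ≢h)

    marked-or-exceptional : ∀ x → Marked x ⊎ Exceptional x
    marked-or-exceptional x with inc? x a
    ... | yes x∈a = inj₁ (on-a-marked x∈a)
    ... | no x∉a with parallelThrough a x ≟ y₁ | parallelThrough a x ≟ y₂
    ...   | yes ≡y₁ | _ = on-y₁-classified (subst (Inc x) ≡y₁ (parallelThrough-inc a x))
    ...   | no _ | yes ≡y₂ = on-y₂-classified (subst (Inc x) ≡y₂ (parallelThrough-inc a x))
    ...   | no ≢y₁ | no ≢y₂ =
      inj₁ (inj₂ (parallelThrough a x , class-line∈S (parallelThrough-∥ a x) ≢a ≢y₁ ≢y₂ , parallelThrough-inc a x))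
      where
      ≢a : parallelThrough a x ≢ a
      ≢a ≡a = x∉a (subst (Inc x) ≡a (parallelThrough-inc a x))

    exceptional-cross : ∀ {x y} → Inc x y₁ → Exceptional₁ x → Inc y y₂ → Exceptional₂ y →
                        vertical x ≢ vertical y
    exceptional-cross x∈y₁ (below-p₁ x-below x∉g) y∈y₂ (below-p₁ y-below y∉g) _ with g-meets-y
    ... | w , w∈g , w-below , inj₁ w∈y₁ =
      x∉g (subst (λ t → Inc t g) (kept-vertical-injective y₁-kept w∈y₁ x∈y₁ (trans w-below (sym x-below))) w∈g)
    ... | w , w∈g , w-below , inj₂ w∈y₂ =
      y∉g (subst (λ t → Inc t g) (kept-vertical-injective y₂-kept w∈y₂ y∈y₂ (trans w-below (sym y-below))) w∈g)
    exceptional-cross _ (below-p₁ x-below _) y∈y₂ (on-k y∈k) vx≡vy =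
      p₁∉y₂ (subst (λ t → Inc t y₂) (p₁-only-below-p₁ k-kept p₁∈k y∈k (trans (sym vx≡vy) x-below)) y∈y₂)
    exceptional-cross _ (below-p₁ x-below _) y∈y₂ (on-h y∈h) vx≡vy =
      p₁∉y₂ (subst (λ t → Inc t y₂) (p₁-only-below-p₁ h-kept p₁∈h y∈h (trans (sym vx≡vy) x-below)) y∈y₂)
    exceptional-cross x∈y₁ (on-h x∈h) _ (below-p₁ y-below _) vx≡vy =
      p₁∉y₁ (subst (λ t → Inc t y₁) (p₁-only-below-p₁ h-kept p₁∈h x∈h (trans vx≡vy y-below)) x∈y₁)
    exceptional-cross x∈y₁ (on-h x∈h) y∈y₂ (on-k y∈k) = no-bad x∈y₁ x∈h y∈y₂ y∈k
    exceptional-cross x∈y₁ (on-h x∈h) y∈y₂ (on-h y∈h) vx≡vy =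
      y₁-avoids-y₂ x∈y₁ (subst (λ t → Inc t y₂) (sym (kept-vertical-injective h-kept x∈h y∈h vx≡vy)) y∈y₂)

    exceptional-vertical-injective : ∀ {x y} → Exceptional x → Exceptional y → vertical x ≡ vertical y → x ≡ y
    exceptional-vertical-injective (inj₁ (x∈y₁ , _)) (inj₁ (y∈y₁ , _)) = kept-vertical-injective y₁-kept x∈y₁ y∈y₁
    exceptional-vertical-injective (inj₂ (x∈y₂ , _)) (inj₂ (y∈y₂ , _)) = kept-vertical-injective y₂-kept x∈y₂ y∈y₂
    exceptional-vertical-injective (inj₁ (x∈y₁ , ex)) (inj₂ (y∈y₂ , ey)) v≡ =
      ⊥-elim (exceptional-cross x∈y₁ ex y∈y₂ ey v≡)
    exceptional-vertical-injective (inj₂ (x∈y₂ , ex)) (inj₁ (y∈y₁ , ey)) v≡ =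
      ⊥-elim (exceptional-cross y∈y₁ ey x∈y₂ ex (sym v≡))

    marked-resolves : ∀ {x y} → Marked x → vertical x ≡ vertical y → x ≢ y → Resolved (inj₁ x) (inj₁ y)
    marked-resolves (inj₁ x∈S) _ x≢y = _ , x∈S , distinguishes-self (x≢y ∘ inj₁-injective)
    marked-resolves (inj₂ (ℓ , ℓ∈S , x∈ℓ)) v≡ x≢y =
      inj₂ ℓ , ℓ∈S , line-separates-vertical (S-line-kept ℓ∈S) x∈ℓ v≡ x≢y

    resolve-same-vertical : ∀ {x y} → vertical x ≡ vertical y → x ≢ y → Resolved (inj₁ x) (inj₁ y)
    resolve-same-vertical {x} {y} v≡ x≢y with marked-or-exceptional x | marked-or-exceptional y
    ... | inj₁ x-marked | _ = marked-resolves x-marked v≡ x≢y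
    ... | inj₂ _ | inj₁ y-marked = resolved-sym (marked-resolves y-marked (sym v≡) (x≢y ∘ sym))
    ... | inj₂ ex | inj₂ ey = ⊥-elim (x≢y (exceptional-vertical-injective ex ey v≡))

    vertical-covered : ∀ {x} → vertical x ≢ vertical p₁ → ∃[ s ] (inj₁ s ∈ S × vertical x ≡ vertical s)
    vertical-covered {x} off with vertical x ≟ vertical p₂
    ... | yes below = m , m∈S , trans below (sym m-below-p₂)
    ... | no off₂ with kept-meets-vertical a-kept x
    ...   | s , s∈a , s-below = s , ∈S-A s∈a s≢p₁ s≢p₂ , sym s-below
      where
      s≢p₁ : s ≢ p₁
      s≢p₁ refl = off (sym s-below)
      s≢p₂ : s ≢ p₂
      s≢p₂ refl = off₂ (sym s-below)

    resolve-points : ∀ {x y} → x ≢ y → Resolved (inj₁ x) (inj₁ y)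
    resolve-points {x} {y} x≢y with vertical x ≟ vertical y
    ... | yes v≡ = resolve-same-vertical v≡ x≢y
    ... | no v≢ with vertical x ≟ vertical p₁
    ...   | no off with vertical-covered off
    ...     | s , s∈S , vx≡vs = inj₁ s , s∈S , vertical-point-separates vx≡vs v≢
    resolve-points {x} {y} x≢y | no v≢ | yes below with vertical-covered {y} (λ v≡ → v≢ (trans below (sym v≡)))
    ...     | s , s∈S , vy≡vs = inj₁ s , s∈S , distinguishes-sym (vertical-point-separates vy≡vs (v≢ ∘ sym))

    LineMarked : Fin nl → Set
    LineMarked ℓ = inj₂ ℓ ∈ S ⊎ ∃[ x ] (inj₁ x ∈ S × Inc x ℓ)

    data ExceptionalLine (ℓ : Fin nl) : Set where
      is-y₂      : ℓ ≡ y₂ → ExceptionalLine ℓ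
      is-h       : ℓ ≡ h → ExceptionalLine ℓ
      through-p₂ : Inc p₂ ℓ → ℓ ≢ g → ℓ ≢ a → ExceptionalLine ℓ

    a-marked : LineMarked a
    a-marked with ∃-point-avoiding 4≤q a p₁ p₂ p₂
    ... | x , x∈a , x≢p₁ , x≢p₂ , _ = inj₂ (x , ∈S-A x∈a x≢p₁ x≢p₂ , x∈a)

    class-a-classified : ∀ {ℓ} → Parallel ℓ a → LineMarked ℓ ⊎ ExceptionalLine ℓ
    class-a-classified {ℓ} ℓ∥a with ℓ ≟ a | ℓ ≟ y₁ | ℓ ≟ y₂
    ... | yes refl | _ | _ = inj₁ a-marked
    ... | no _ | yes refl | _ = inj₁ (inj₂ (m , m∈S , m∈y₁))
    ... | no _ | no _ | yes ℓ≡y₂ = inj₂ (is-y₂ ℓ≡y₂)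
    ... | no ≢a | no ≢y₁ | no ≢y₂ = inj₁ (inj₁ (class-line∈S ℓ∥a ≢a ≢y₁ ≢y₂))

    pencil-classified : ∀ {ℓ} → Kept ℓ → Inc p₁ ℓ → ℓ ≢ a → LineMarked ℓ ⊎ ExceptionalLine ℓ
    pencil-classified {ℓ} kept p₁∈ℓ ℓ≢a with ℓ ≟ k | ℓ ≟ h
    ... | yes refl | _ = inj₁ (inj₂ (m , m∈S , m∈k))
    ... | no _ | yes ℓ≡h = inj₂ (is-h ℓ≡h)
    ... | no ≢k | no ≢h = inj₁ (inj₁ (pencil-line∈S kept p₁∈ℓ ℓ≢a ≢k ≢h))

    line-marked-or-exceptional : ∀ {ℓ} → Kept ℓ → LineMarked ℓ ⊎ ExceptionalLine ℓ
    line-marked-or-exceptional {ℓ} kept with parallel? ℓ a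
    ... | yes ℓ∥a = class-a-classified ℓ∥a
    ... | no ℓ∦a with ¬∥⇒meet ℓ∦a
    ...   | e , e∈ℓ , e∈a with e ≟ p₁ | e ≟ p₂
    ...     | yes refl | _ = pencil-classified kept e∈ℓ (ℓ∦a ∘ inj₁)
    ...     | no _ | yes refl with ℓ ≟ g
    ...       | yes refl = inj₁ (inj₁ g∈S)
    ...       | no ℓ≢g = inj₂ (through-p₂ e∈ℓ ℓ≢g (ℓ∦a ∘ inj₁))
    line-marked-or-exceptional kept | no _ | e , e∈ℓ , e∈a | no e≢p₁ | no e≢p₂ =
      inj₁ (inj₂ (e , ∈S-A e∈a e≢p₁ e≢p₂ , e∈ℓ))

    exceptional-lines-∥⇒≡ : ∀ {ℓ n} → ExceptionalLine ℓ → ExceptionalLine n → Parallel ℓ n → ℓ ≡ n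
    exceptional-lines-∥⇒≡ (is-y₂ ℓ≡y₂) (is-y₂ n≡y₂) _ = trans ℓ≡y₂ (sym n≡y₂)
    exceptional-lines-∥⇒≡ (is-h ℓ≡h) (is-h n≡h) _ = trans ℓ≡h (sym n≡h)
    exceptional-lines-∥⇒≡ (through-p₂ p₂∈ℓ _ _) (through-p₂ p₂∈n _ _) ℓ∥n = ∥-common⇒≡ ℓ∥n p₂∈ℓ p₂∈n
    exceptional-lines-∥⇒≡ (is-y₂ refl) (is-h refl) y₂∥h = ⊥-elim (h∦a (∥-trans (∥-sym y₂∥h) y₂∥a))
    exceptional-lines-∥⇒≡ (is-h refl) (is-y₂ refl) h∥y₂ = ⊥-elim (h∦a (∥-trans h∥y₂ y₂∥a))
    exceptional-lines-∥⇒≡ (is-y₂ refl) (through-p₂ p₂∈n _ n≢a) y₂∥n =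
      ⊥-elim (n≢a (∥-common⇒≡ (∥-trans (∥-sym y₂∥n) y₂∥a) p₂∈n p₂∈a))
    exceptional-lines-∥⇒≡ (through-p₂ p₂∈ℓ _ ℓ≢a) (is-y₂ refl) ℓ∥y₂ =
      ⊥-elim (ℓ≢a (∥-common⇒≡ (∥-trans ℓ∥y₂ y₂∥a) p₂∈ℓ p₂∈a))
    exceptional-lines-∥⇒≡ (is-h refl) (through-p₂ p₂∈n n≢g _) h∥n =
      ⊥-elim (n≢g (∥-common⇒≡ (∥-trans (∥-sym h∥n) h∥g) p₂∈n p₂∈g))
    exceptional-lines-∥⇒≡ (through-p₂ p₂∈ℓ ℓ≢g _) (is-h refl) ℓ∥h =
      ⊥-elim (ℓ≢g (∥-common⇒≡ (∥-trans ℓ∥h h∥g) p₂∈ℓ p₂∈g))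

    line-marked-resolves : ∀ {ℓ n} → Kept ℓ → LineMarked ℓ → Parallel ℓ n → ℓ ≢ n →
                           Resolved (inj₂ ℓ) (inj₂ n)
    line-marked-resolves _ (inj₁ ℓ∈S) _ ℓ≢n = _ , ℓ∈S , distinguishes-self (ℓ≢n ∘ inj₂-injective)
    line-marked-resolves kept (inj₂ (x , x∈S , x∈ℓ)) ℓ∥n ℓ≢n =
      inj₁ x , x∈S , point-separates-parallels kept x∈ℓ ℓ∥n ℓ≢n

    resolve-parallel : ∀ {ℓ n} → Kept ℓ → Kept n → Parallel ℓ n → ℓ ≢ n → Resolved (inj₂ ℓ) (inj₂ n)
    resolve-parallel ℓ-kept n-kept ℓ∥n ℓ≢n
      with line-marked-or-exceptional ℓ-kept | line-marked-or-exceptional n-kept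
    ... | inj₁ ℓ-marked | _ = line-marked-resolves ℓ-kept ℓ-marked ℓ∥n ℓ≢n
    ... | inj₂ _ | inj₁ n-marked = resolved-sym (line-marked-resolves n-kept n-marked (∥-sym ℓ∥n) (ℓ≢n ∘ sym))
    ... | inj₂ eℓ | inj₂ en = ⊥-elim (ℓ≢n (exceptional-lines-∥⇒≡ eℓ en ℓ∥n))

    class-covered : ∀ {ℓ} → Kept ℓ → ¬ Parallel ℓ k → ∃[ s ] (inj₂ s ∈ S × Parallel ℓ s)
    class-covered {ℓ} kept ℓ∦k with parallel? ℓ a
    ... | yes ℓ∥a with ∃-point-avoiding 4≤q (vertical p₁) p₁ w₁ w₂
    ...   | x , x∈ , x≢p₁ , x≢w₁ , x≢w₂ =
      parallelThrough a x , ∈S-Y (on-vertical⇒≡ x∈) x≢p₁ x≢w₁ x≢w₂ , ∥-trans ℓ∥a (∥-sym (parallelThrough-∥ a x))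
    class-covered {ℓ} kept ℓ∦k | no ℓ∦a with parallelThrough ℓ p₁ ≟ h
    ... | yes ≡h = g , g∈S , ∥-trans (∥-sym ℓ′∥ℓ) (subst (λ l → Parallel l g) (sym ≡h) h∥g)
      where
      ℓ′∥ℓ = parallelThrough-∥ ℓ p₁
    ... | no ≢h = parallelThrough ℓ p₁ , pencil-line∈S (kept-∥ ℓ′∥ℓ kept) (parallelThrough-inc ℓ p₁) ≢a ≢k ≢h ,
                  ∥-sym ℓ′∥ℓ
      where
      ℓ′∥ℓ = parallelThrough-∥ ℓ p₁
      ≢a : parallelThrough ℓ p₁ ≢ a
      ≢a ≡a = ℓ∦a (subst (Parallel ℓ) ≡a (∥-sym ℓ′∥ℓ))
      ≢k : parallelThrough ℓ p₁ ≢ k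
      ≢k ≡k = ℓ∦k (subst (Parallel ℓ) ≡k (∥-sym ℓ′∥ℓ))

    resolve-lines : ∀ {ℓ n} → Kept ℓ → Kept n → ℓ ≢ n → Resolved (inj₂ ℓ) (inj₂ n)
    resolve-lines {ℓ} {n} ℓ-kept n-kept ℓ≢n with parallel? ℓ n
    ... | yes ℓ∥n = resolve-parallel ℓ-kept n-kept ℓ∥n ℓ≢n
    ... | no ℓ∦n with parallel? ℓ k
    ...   | no ℓ∦k with class-covered ℓ-kept ℓ∦k
    ...     | s , s∈S , ℓ∥s = inj₂ s , s∈S , parallel-line-separates (S-line-kept s∈S) n-kept ℓ∥s ℓ∦n
    resolve-lines {ℓ} {n} ℓ-kept n-kept ℓ≢n | no ℓ∦n | yes ℓ∥k
      with class-covered n-kept (λ n∥k → ℓ∦n (∥-trans ℓ∥k (∥-sym n∥k)))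
    ...     | s , s∈S , n∥s =
      inj₂ s , s∈S , distinguishes-sym (parallel-line-separates (S-line-kept s∈S) ℓ-kept n∥s (ℓ∦n ∘ ∥-sym))

    resolving : Resolving S
    resolving (inj₁ x) (inj₁ y) _ _ u≢v = resolve-points (u≢v ∘ cong inj₁)
    resolving (inj₂ ℓ) (inj₂ n) ℓ-kept n-kept u≢v = resolve-lines ℓ-kept n-kept (u≢v ∘ cong inj₂)
    resolving (inj₁ x) (inj₂ ℓ) _ _ _ = inj₁ m , m∈S , point-separates-point-line m x ℓ
    resolving (inj₂ ℓ) (inj₁ x) _ _ _ = inj₁ m , m∈S , distinguishes-sym (point-separates-point-line m x ℓ)

  record Parallelogram (b : Fin nl) (p p′ : Fin np) (y : Fin nl) (w w′ : Fin np) : Set where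
    constructor mkParallelogram
    field
      base-kept   : Kept b
      p∈base      : Inc p b
      p′∈base     : Inc p′ b
      p≢p′        : p ≢ p′
      side∥base   : Parallel y b
      side≢base   : y ≢ b
      w∈side      : Inc w y
      w-below-p   : vertical w ≡ vertical p
      w′∈side     : Inc w′ y
      w′-below-p′ : vertical w′ ≡ vertical p′

  parallelogram? : ∀ b p p′ y w w′ → Dec (Parallelogram b p p′ y w w′)
  parallelogram? b p p′ y w w′ =
    map′ (λ (k , i , i′ , ne , s∥ , s≢ , wi , wb , w′i , w′b) → mkParallelogram k i i′ ne s∥ s≢ wi wb w′i w′b)
         (λ (mkParallelogram k i i′ ne s∥ s≢ wi wb w′i w′b) → k , i , i′ , ne , s∥ , s≢ , wi , wb , w′i , w′b)
         (kept? b ×-dec inc? p b ×-dec inc? p′ b ×-dec ¬? (p ≟ p′) ×-dec parallel? y b ×-dec ¬? (y ≟ b) ×-dec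
          inc? w y ×-dec vertical w ≟ vertical p ×-dec inc? w′ y ×-dec vertical w′ ≟ vertical p′)

  DiagonalsParallel : Set
  DiagonalsParallel = ∀ {b p p′ y w w′} → Parallelogram b p p′ y w w′ →
                      Parallel (lineThrough p′ w) (lineThrough p w′)

  SkewParallelogram : Set
  SkewParallelogram = ∃[ b ] ∃[ p ] ∃[ p′ ] ∃[ y ] ∃[ w ] ∃[ w′ ]
    (Parallelogram b p p′ y w w′ × ¬ Parallel (lineThrough p′ w) (lineThrough p w′))

  diagonals-parallel-or-skew : DiagonalsParallel ⊎ SkewParallelogram
  diagonals-parallel-or-skew
    with any? (λ b → any? λ p → any? λ p′ → any? λ y → any? λ w → any? λ w′ →
         parallelogram? b p p′ y w w′ ×-dec ¬? (parallel? (lineThrough p′ w) (lineThrough p w′)))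
  ... | yes skew = inj₂ skew
  ... | no none = inj₁ λ {b} {p} {p′} {y} {w} {w′} P →
        decidable-stable (parallel? _ _) λ skew → none (b , p , p′ , y , w , w′ , P , skew)

  parallelThrough-avoids : ∀ {a ℓ x e} → Kept a → Parallel ℓ a → Inc e ℓ → vertical x ≡ vertical e → x ≢ e →
                           parallelThrough a x ≢ ℓ
  parallelThrough-avoids {a} {x = x} a-kept ℓ∥a e∈ℓ vx≡ve x≢e ≡ℓ =
    x≢e (kept-vertical-injective (kept-∥ ℓ∥a a-kept) (subst (Inc x) ≡ℓ (parallelThrough-inc a x)) e∈ℓ vx≡ve)

  ∃-class-line-avoiding : 4 ≤ q → ∀ {a ℓ₁ ℓ₂ ℓ₃} → Kept a → Parallel ℓ₁ a → Parallel ℓ₂ a → Parallel ℓ₃ a →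
                          ∃[ y ] (Parallel y a × y ≢ ℓ₁ × y ≢ ℓ₂ × y ≢ ℓ₃)
  ∃-class-line-avoiding 4≤q {a} a-kept ℓ₁∥a ℓ₂∥a ℓ₃∥a
    with ∃-point-avoiding 4≤q (vertical o) (crossing (kept-∥ ℓ₁∥a a-kept) o)
           (crossing (kept-∥ ℓ₂∥a a-kept) o) (crossing (kept-∥ ℓ₃∥a a-kept) o)
    where
    o = proj₁ noncollinear
  ... | x , x∈ , x≢e₁ , x≢e₂ , x≢e₃ =
    parallelThrough a x , parallelThrough-∥ a x , avoids ℓ₁∥a x≢e₁ , avoids ℓ₂∥a x≢e₂ , avoids ℓ₃∥a x≢e₃
    where
    avoids : ∀ {ℓ} (ℓ∥a : Parallel ℓ a) → x ≢ crossing (kept-∥ ℓ∥a a-kept) (proj₁ noncollinear) →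
             parallelThrough a x ≢ ℓ
    avoids ℓ∥a = parallelThrough-avoids a-kept ℓ∥a (crossing-inc (kept-∥ ℓ∥a a-kept) _)
                   (trans (on-vertical⇒≡ x∈) (sym (crossing-below (kept-∥ ℓ∥a a-kept) _)))

  two-points-on-a-kept-line : ∃[ a ] ∃[ p₁ ] ∃[ p₂ ] (Kept a × Inc p₁ a × Inc p₂ a × p₁ ≢ p₂)
  two-points-on-a-kept-line with noncollinear
  ... | x , y , z , noncol with vertical x ≟ vertical y | vertical x ≟ vertical z
  ...   | no vx≢vy | _ = lineThrough x y , x , y , lineThrough-kept vx≢vy , lineThrough-inc x≢y .proj₁ ,
                         lineThrough-inc x≢y .proj₂ , x≢y
    where x≢y = distinct-verticals⇒≢ vx≢vy
  ...   | yes _ | no vx≢vz = lineThrough x z , x , z , lineThrough-kept vx≢vz , lineThrough-inc x≢z .proj₁ ,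
                         lineThrough-inc x≢z .proj₂ , x≢z
    where x≢z = distinct-verticals⇒≢ vx≢vz
  ...   | yes vx≡vy | yes vx≡vz =
    ⊥-elim (noncol (vertical x , vertical-inc x , ≡⇒on-vertical (sym vx≡vy) , ≡⇒on-vertical (sym vx≡vz)))

  module SkewDiagonals (4≤q : 4 ≤ q) {a p₁ p₂ y₁ w₁ m} (P : Parallelogram a p₁ p₂ y₁ w₁ m)
                       (skew : ¬ Parallel (lineThrough p₂ w₁) (lineThrough p₁ m)) where
    open Parallelogram P renaming
      ( base-kept to a-kept; p∈base to p₁∈a; p′∈base to p₂∈a; p≢p′ to p₁≢p₂; side∥base to y₁∥a
      ; side≢base to y₁≢a; w∈side to w₁∈y₁; w-below-p to w₁-below-p₁; w′∈side to m∈y₁; w′-below-p′ to m-below-p₂)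

    g h k : Fin nl
    g = lineThrough p₂ w₁
    h = parallelThrough g p₁
    k = lineThrough p₁ m

    vp₁≢vp₂ : vertical p₁ ≢ vertical p₂
    vp₁≢vp₂ v≡ = p₁≢p₂ (kept-vertical-injective a-kept p₁∈a p₂∈a v≡)

    vp₂≢vw₁ : vertical p₂ ≢ vertical w₁
    vp₂≢vw₁ v≡ = vp₁≢vp₂ (sym (trans v≡ w₁-below-p₁))

    vp₁≢vm : vertical p₁ ≢ vertical m
    vp₁≢vm v≡ = vp₁≢vp₂ (trans v≡ m-below-p₂)

    p₂∈g : Inc p₂ g
    p₂∈g = proj₁ (lineThrough-inc (distinct-verticals⇒≢ vp₂≢vw₁))

    w₁∈g : Inc w₁ g
    w₁∈g = proj₂ (lineThrough-inc (distinct-verticals⇒≢ vp₂≢vw₁))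

    p₁≢m : p₁ ≢ m
    p₁≢m = distinct-verticals⇒≢ vp₁≢vm

    h∥g : Parallel h g
    h∥g = parallelThrough-∥ g p₁

    p₁∈h : Inc p₁ h
    p₁∈h = parallelThrough-inc g p₁

    m∉h : ¬ Inc m h
    m∉h m∈h = skew (subst (Parallel g) (lineThrough-unique p₁≢m p₁∈h m∈h) (∥-sym h∥g))

    h∦y₁ : ¬ Parallel h y₁
    h∦y₁ h∥y₁ = distinct-parallels-disjoint y₁∥a y₁≢a w₁∈y₁ (subst (Inc w₁) g≡a w₁∈g)
      where
      g≡a : g ≡ a
      g≡a = ∥-common⇒≡ (∥-trans (∥-sym h∥g) (∥-trans h∥y₁ y₁∥a)) p₂∈g p₂∈a

    k-kept : Kept k
    k-kept = lineThrough-kept vp₁≢vm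

    b : Fin np
    b = proj₁ (¬∥⇒meet h∦y₁)

    b∈h : Inc b h
    b∈h = proj₁ (proj₂ (¬∥⇒meet h∦y₁))

    b∈y₁ : Inc b y₁
    b∈y₁ = proj₂ (proj₂ (¬∥⇒meet h∦y₁))

    c : Fin np
    c = crossing k-kept b

    -- Keeping y₂ off the parallel to a through c (on k, below h ∩ y₁) is what secures no-bad.
    configuration-avoiding : ∃[ y₂ ] (Parallel y₂ a × y₂ ≢ a × y₂ ≢ y₁ × y₂ ≢ parallelThrough a c) →
                             Configuration
    configuration-avoiding (y₂ , y₂∥a , y₂≢a , y₂≢y₁ , y₂≢ac) = record
      { a = a ; a-kept = a-kept ; p₁ = p₁ ; p₂ = p₂ ; p₁∈a = p₁∈a ; p₂∈a = p₂∈a ; p₁≢p₂ = p₁≢p₂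
      ; y₁ = y₁ ; y₂ = y₂ ; y₁∥a = y₁∥a ; y₂∥a = y₂∥a ; y₁≢a = y₁≢a ; y₂≢a = y₂≢a ; y₁≢y₂ = y₂≢y₁ ∘ sym
      ; m = m ; m∈y₁ = m∈y₁ ; m-below-p₂ = m-below-p₂
      ; g = g ; g-kept = lineThrough-kept vp₂≢vw₁ ; p₂∈g = p₂∈g ; g-meets-y = w₁ , w₁∈g , w₁-below-p₁ , inj₁ w₁∈y₁
      ; m∉h = m∉h ; no-bad = no-bad
      }
      where
      no-bad : ∀ {x y} → Inc x y₁ → Inc x h → Inc y y₂ → Inc y k → vertical x ≢ vertical y
      no-bad {x} {y} x∈y₁ x∈h y∈y₂ y∈k vx≡vy = y₂≢ac (parallelThrough-unique c∈y₂ y₂∥a)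
        where
        x≡b : x ≡ b
        x≡b = meet-unique (λ h≡y₁ → h∦y₁ (subst (Parallel h) h≡y₁ ∥-refl)) x∈h x∈y₁ b∈h b∈y₁
        y≡c : y ≡ c
        y≡c = kept-vertical-injective k-kept y∈k (crossing-inc k-kept b)
                (trans (sym vx≡vy) (trans (cong vertical x≡b) (sym (crossing-below k-kept b))))
        c∈y₂ : Inc c y₂
        c∈y₂ = subst (λ t → Inc t y₂) y≡c y∈y₂

    configuration : Configuration
    configuration = configuration-avoiding (∃-class-line-avoiding 4≤q a-kept ∥-refl y₁∥a (parallelThrough-∥ a c))

  module ParallelDiagonals (parallel-diagonals : DiagonalsParallel)
      {a p₁ p₂} (a-kept : Kept a) (p₁∈a : Inc p₁ a) (p₂∈a : Inc p₂ a) (p₁≢p₂ : p₁ ≢ p₂)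
      {y₁ y₂} (y₁∥a : Parallel y₁ a) (y₂∥a : Parallel y₂ a) (y₁≢a : y₁ ≢ a) (y₂≢a : y₂ ≢ a) (y₁≢y₂ : y₁ ≢ y₂)
      where

    y₁-kept : Kept y₁
    y₁-kept = kept-∥ y₁∥a a-kept

    y₂-kept : Kept y₂
    y₂-kept = kept-∥ y₂∥a a-kept

    y₁-avoids-y₂ : ∀ {x} → Inc x y₁ → ¬ Inc x y₂
    y₁-avoids-y₂ = distinct-parallels-disjoint (∥-trans y₁∥a (∥-sym y₂∥a)) y₁≢y₂

    vp₁≢vp₂ : vertical p₁ ≢ vertical p₂
    vp₁≢vp₂ v≡ = p₁≢p₂ (kept-vertical-injective a-kept p₁∈a p₂∈a v≡)

    w₁ m x₂ m₂ : Fin np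
    w₁ = crossing y₁-kept p₁
    m = crossing y₁-kept p₂
    x₂ = crossing y₂-kept p₁
    m₂ = crossing y₂-kept p₂

    w₁∈y₁ : Inc w₁ y₁
    w₁∈y₁ = crossing-inc y₁-kept p₁

    m∈y₁ : Inc m y₁
    m∈y₁ = crossing-inc y₁-kept p₂

    x₂∈y₂ : Inc x₂ y₂
    x₂∈y₂ = crossing-inc y₂-kept p₁

    m₂∈y₂ : Inc m₂ y₂
    m₂∈y₂ = crossing-inc y₂-kept p₂

    w₁-below-p₁ : vertical w₁ ≡ vertical p₁
    w₁-below-p₁ = crossing-below y₁-kept p₁

    m-below-p₂ : vertical m ≡ vertical p₂
    m-below-p₂ = crossing-below y₁-kept p₂

    x₂-below-p₁ : vertical x₂ ≡ vertical p₁
    x₂-below-p₁ = crossing-below y₂-kept p₁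

    m₂-below-p₂ : vertical m₂ ≡ vertical p₂
    m₂-below-p₂ = crossing-below y₂-kept p₂

    vp₂≢vx₂ : vertical p₂ ≢ vertical x₂
    vp₂≢vx₂ v≡ = vp₁≢vp₂ (sym (trans v≡ x₂-below-p₁))

    g h k : Fin nl
    g = lineThrough p₂ x₂
    h = parallelThrough g p₁
    k = lineThrough p₁ m

    g-kept : Kept g
    g-kept = lineThrough-kept vp₂≢vx₂

    p₂∈g : Inc p₂ g
    p₂∈g = proj₁ (lineThrough-inc (distinct-verticals⇒≢ vp₂≢vx₂))

    x₂∈g : Inc x₂ g
    x₂∈g = proj₂ (lineThrough-inc (distinct-verticals⇒≢ vp₂≢vx₂))

    h∥g : Parallel h g
    h∥g = parallelThrough-∥ g p₁

    p₁∈h : Inc p₁ h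
    p₁∈h = parallelThrough-inc g p₁

    vertical-parallelogram : ∀ {y} (y∥a : Parallel y a) → y ≢ a →
      Parallelogram a p₁ p₂ y (crossing (kept-∥ y∥a a-kept) p₁) (crossing (kept-∥ y∥a a-kept) p₂)
    vertical-parallelogram y∥a y≢a = mkParallelogram a-kept p₁∈a p₂∈a p₁≢p₂ y∥a y≢a
      (crossing-inc y-kept p₁) (crossing-below y-kept p₁) (crossing-inc y-kept p₂) (crossing-below y-kept p₂)
      where y-kept = kept-∥ y∥a a-kept

    p₁≢m : p₁ ≢ m
    p₁≢m = distinct-verticals⇒≢ λ v≡ → vp₁≢vp₂ (trans v≡ m-below-p₂)

    p₁∈k : Inc p₁ k
    p₁∈k = proj₁ (lineThrough-inc p₁≢m)

    m∈k : Inc m k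
    m∈k = proj₂ (lineThrough-inc p₁≢m)

    m₂∈h : Inc m₂ h
    m₂∈h = subst (Inc m₂) (sym h≡p₁m₂) (proj₂ (lineThrough-inc p₁≢m₂))
      where
      p₁≢m₂ : p₁ ≢ m₂
      p₁≢m₂ = distinct-verticals⇒≢ λ v≡ → vp₁≢vp₂ (trans v≡ m₂-below-p₂)
      h≡p₁m₂ : h ≡ lineThrough p₁ m₂
      h≡p₁m₂ = ∥-through-unique p₁∈h h∥g (proj₁ (lineThrough-inc p₁≢m₂))
                 (∥-sym (parallel-diagonals (vertical-parallelogram y₂∥a y₂≢a)))

    m∉h : ¬ Inc m h
    m∉h m∈h = y₁-avoids-y₂ w₁∈y₁ (subst (λ t → Inc t y₂) (sym w₁≡x₂) x₂∈y₂)
      where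
      p₂≢w₁ : p₂ ≢ w₁
      p₂≢w₁ = distinct-verticals⇒≢ λ v≡ → vp₁≢vp₂ (sym (trans v≡ w₁-below-p₁))
      p₂w₁≡g : lineThrough p₂ w₁ ≡ g
      p₂w₁≡g = ∥-common⇒≡
        (∥-trans (parallel-diagonals (vertical-parallelogram y₁∥a y₁≢a))
                 (subst (λ l → Parallel l g) (lineThrough-unique p₁≢m p₁∈h m∈h) h∥g))
        (proj₁ (lineThrough-inc p₂≢w₁)) p₂∈g
      w₁≡x₂ : w₁ ≡ x₂
      w₁≡x₂ = kept-vertical-injective g-kept (subst (Inc w₁) p₂w₁≡g (proj₂ (lineThrough-inc p₂≢w₁))) x₂∈g
                (trans w₁-below-p₁ (sym x₂-below-p₁))

    -- The parallelogram m x y m₂ forces h ∥ k, so h = k would contain m.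
    no-bad : ∀ {x y} → Inc x y₁ → Inc x h → Inc y y₂ → Inc y k → vertical x ≢ vertical y
    no-bad {x} {y} x∈y₁ x∈h y∈y₂ y∈k vx≡vy = m∉h (subst (Inc m) (sym h≡k) m∈k)
      where
      m≢x : m ≢ x
      m≢x refl = m∉h x∈h
      x≢m₂ : x ≢ m₂
      x≢m₂ refl = y₁-avoids-y₂ x∈y₁ m₂∈y₂
      m≢y : m ≢ y
      m≢y refl = y₁-avoids-y₂ m∈y₁ y∈y₂
      diagonals : Parallel (lineThrough x m₂) (lineThrough m y)
      diagonals = parallel-diagonals (mkParallelogram y₁-kept m∈y₁ x∈y₁ m≢x
        (∥-trans y₂∥a (∥-sym y₁∥a)) (y₁≢y₂ ∘ sym) m₂∈y₂
        (trans m₂-below-p₂ (sym m-below-p₂)) y∈y₂ (sym vx≡vy))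
      h≡k : h ≡ k
      h≡k = ∥-common⇒≡ (subst₂ Parallel (sym (lineThrough-unique x≢m₂ x∈h m₂∈h))
                                          (sym (lineThrough-unique m≢y m∈k y∈k)) diagonals)
              p₁∈h p₁∈k

    configuration : Configuration
    configuration = record
      { a = a ; a-kept = a-kept ; p₁ = p₁ ; p₂ = p₂ ; p₁∈a = p₁∈a ; p₂∈a = p₂∈a ; p₁≢p₂ = p₁≢p₂
      ; y₁ = y₁ ; y₂ = y₂ ; y₁∥a = y₁∥a ; y₂∥a = y₂∥a ; y₁≢a = y₁≢a ; y₂≢a = y₂≢a ; y₁≢y₂ = y₁≢y₂
      ; m = m ; m∈y₁ = m∈y₁ ; m-below-p₂ = m-below-p₂
      ; g = g ; g-kept = g-kept ; p₂∈g = p₂∈g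
      ; g-meets-y = x₂ , x₂∈g , x₂-below-p₁ , inj₂ x₂∈y₂
      ; m∉h = m∉h ; no-bad = no-bad
      }

  ∃-two-class-lines : 4 ≤ q → ∀ {a} → Kept a →
                      ∃[ y₁ ] ∃[ y₂ ] (Parallel y₁ a × Parallel y₂ a × y₁ ≢ a × y₂ ≢ a × y₁ ≢ y₂)
  ∃-two-class-lines 4≤q {a} a-kept = add-second (∃-class-line-avoiding 4≤q a-kept ∥-refl ∥-refl ∥-refl)
    where
    add-second : ∃[ y₁ ] (Parallel y₁ a × y₁ ≢ a × y₁ ≢ a × y₁ ≢ a) →
                 ∃[ y₁ ] ∃[ y₂ ] (Parallel y₁ a × Parallel y₂ a × y₁ ≢ a × y₂ ≢ a × y₁ ≢ y₂)
    add-second (y₁ , y₁∥a , y₁≢a , _) = pair (∃-class-line-avoiding 4≤q a-kept ∥-refl y₁∥a y₁∥a)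
      where
      pair : ∃[ y₂ ] (Parallel y₂ a × y₂ ≢ a × y₂ ≢ y₁ × y₂ ≢ y₁) →
             ∃[ y₁ ] ∃[ y₂ ] (Parallel y₁ a × Parallel y₂ a × y₁ ≢ a × y₂ ≢ a × y₁ ≢ y₂)
      pair (y₂ , y₂∥a , y₂≢a , y₂≢y₁ , _) = y₁ , y₂ , y₁∥a , y₂∥a , y₁≢a , y₂≢a , y₂≢y₁ ∘ sym

  ∃-configuration : 4 ≤ q → Configuration
  ∃-configuration 4≤q = [ from-parallel-diagonals , from-skew ]′ diagonals-parallel-or-skew
    where
    from-skew : SkewParallelogram → Configuration
    from-skew (_ , _ , _ , _ , _ , _ , P , skew) = SkewDiagonals.configuration 4≤q P skew

    from-parallel-diagonals : DiagonalsParallel → Configuration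
    from-parallel-diagonals parallel-diagonals with two-points-on-a-kept-line
    ... | a , p₁ , p₂ , a-kept , p₁∈a , p₂∈a , p₁≢p₂ = with-sides (∃-two-class-lines 4≤q a-kept)
      where
      with-sides : ∃[ y₁ ] ∃[ y₂ ] (Parallel y₁ a × Parallel y₂ a × y₁ ≢ a × y₂ ≢ a × y₁ ≢ y₂) → Configuration
      with-sides (_ , _ , y₁∥a , y₂∥a , y₁≢a , y₂≢a , y₁≢y₂) =
        ParallelDiagonals.configuration parallel-diagonals a-kept p₁∈a p₂∈a p₁≢p₂ y₁∥a y₂∥a y₁≢a y₂≢a y₁≢y₂

  resolving-set : 4 ≤ q → Configuration → ∃[ S ] (All Valid S × length S ≤ 3 * q ∸ 6 × Resolving S)
  resolving-set 4≤q C = S , valid , size , resolving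
    where open ResolvingSet 4≤q C

mainTheorem3 : (q : ℕ) → 4 ≤ q → (np nl : ℕ) → (I : Fin np → Fin nl → Bool) →
    Incidence.IsAffinePlane I q → (ℓ₀ : Fin nl) →
    ∃[ S ] (All (Incidence.Biaffine.Valid I ℓ₀) S × length S ≤ 3 * q ∸ 6 ×
            Incidence.Biaffine.Resolving I ℓ₀ S)
mainTheorem3 q 4≤q np nl I plane ℓ₀ = resolving-set 4≤q (∃-configuration 4≤q)
  where open Configurations plane ℓ₀
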